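{- $\widehat{K}_{3,4}\notin\mathfrak{N}$.
   Context: All graphs are finite, without loops or multiple edges. An interval $t$-coloring of a graph $H$ is a proper edge-coloring of $H$ with colors $1,\ldots,t$ such that every color is used and for every vertex $v$ the set of colors of edges incident to $v$ is an interval of integers. $\mathfrak{N}$ denotes the set of graphs having an interval $t$-coloring for some positive integer $t$. $K_{3,4}$ is the complete bipartite graph with parts of sizes $3$ and $4$. For a graph $G$, $\widehat{G}$ is the graph obtained by subdividing every edge $v_iv_j$ of $G$ with a new vertex $w_{ij}$ (replacing $v_iv_j$ by $v_iw_{ij},v_jw_{ij}$) and then adding a new vertex $u$ adjacent to all the subdivision vertices $w_{ij}$. Thus $\widehat{K}_{3,4}$ is a bipartite graph with $20$ vertices and maximum degree $12$. -}

module Defs where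

open import Data.Nat using (ℕ; _≤_; _<_)
open import Data.Fin using (Fin)
open import Data.Unit using (⊤; tt)
open import Data.Empty using (⊥)
open import Data.Sum using (_⊎_; inj₁; inj₂)
open import Data.Product using (Σ; ∃; ∃-syntax; _×_; _,_)
open import Relation.Nullary using (¬_)
open import Relation.Binary.PropositionalEquality using (_≡_; refl)

record Graph : Set₁ where
  field
    V     : Set
    E     : V → V → Set
    symE  : ∀ {u v} → E u v → E v u
    irr   : ∀ {u} → ¬ E u u
open Graph public

record IntervalColouring (G : Graph) (t : ℕ) : Set where
  field
    col       : (u v : V G) → E G u v → ℕ
    col-sym   : ∀ u v (e : E G u v) → col u v e ≡ col v u (symE G e)
    col-range : ∀ u v (e : E G u v) → 1 ≤ col u v e × col u v e ≤ t
    proper    : ∀ u v w (e : E G u v) (e′ : E G u w) →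
                col u v e ≡ col u w e′ → v ≡ w
    surj      : ∀ k → 1 ≤ k → k ≤ t → ∃[ u ] ∃[ v ] Σ (E G u v) λ e → col u v e ≡ k
    interval  : ∀ v a b k →
                (∃[ x ] Σ (E G v x) λ e → col v x e ≡ a) →
                (∃[ y ] Σ (E G v y) λ e → col v y e ≡ b) →
                a ≤ k → k ≤ b →
                ∃[ z ] Σ (E G v z) λ e → col v z e ≡ k

InN : Graph → Set
InN G = ∃[ t ] (1 ≤ t × IntervalColouring G t)

-- The construction Ĝ applied to G = K_{m,n}.  The edges of K_{m,n} are exactly
-- the pairs (i , j) with i in the first part and j in the second, so the
-- vertices of K̂_{m,n} are
--   a i      (original vertex v_i of the first part)      : inj₁ (inj₁ i)
--   b j      (original vertex of the second part)         : inj₁ (inj₂ j)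
--   w (i,j)  (subdivision vertex of the edge a_i b_j)     : inj₂ (inj₁ (i , j))
--   u        (the new vertex)                             : inj₂ (inj₂ tt)
HV : ℕ → ℕ → Set
HV m n = (Fin m ⊎ Fin n) ⊎ ((Fin m × Fin n) ⊎ ⊤)

HE : ∀ {m n} → HV m n → HV m n → Set
HE (inj₁ (inj₁ i)) (inj₂ (inj₁ (i′ , _))) = i ≡ i′
HE (inj₁ (inj₂ j)) (inj₂ (inj₁ (_ , j′))) = j ≡ j′
HE (inj₂ (inj₁ (i′ , _))) (inj₁ (inj₁ i)) = i ≡ i′
HE (inj₂ (inj₁ (_ , j′))) (inj₁ (inj₂ j)) = j ≡ j′
HE (inj₂ (inj₁ _)) (inj₂ (inj₂ _)) = ⊤
HE (inj₂ (inj₂ _)) (inj₂ (inj₁ _)) = ⊤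
HE _ _ = ⊥

HE-sym : ∀ {m n} {x y : HV m n} → HE x y → HE y x
HE-sym {x = inj₁ (inj₁ i)} {inj₂ (inj₁ _)} e = e
HE-sym {x = inj₁ (inj₂ j)} {inj₂ (inj₁ _)} e = e
HE-sym {x = inj₂ (inj₁ _)} {inj₁ (inj₁ _)} e = e
HE-sym {x = inj₂ (inj₁ _)} {inj₁ (inj₂ _)} e = e
HE-sym {x = inj₂ (inj₁ _)} {inj₂ (inj₂ _)} e = tt
HE-sym {x = inj₂ (inj₂ _)} {inj₂ (inj₁ _)} e = tt

HE-irr : ∀ {m n} {x : HV m n} → ¬ HE x x
HE-irr {x = inj₁ (inj₁ _)} ()
HE-irr {x = inj₁ (inj₂ _)} ()
HE-irr {x = inj₂ (inj₁ _)} ()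
HE-irr {x = inj₂ (inj₂ _)} ()

hatK : ℕ → ℕ → Graph
hatK m n = record { V = HV m n ; E = HE ; symE = HE-sym ; irr = HE-irr }

module Submission where

-- Suppose K̂_{m,n} has one, and write α i j, β i j, γ i j for the colours of the
-- edges a_i w_ij, b_j w_ij and u w_ij.  In an interval colouring the colours at a
-- vertex of degree d form an interval of d integers, so any two of them differ by
-- at most d − 1; we apply this at a_i (degree n), b_j (degree m) and w_ij
-- (degree 3).  Since α i j ≠ β i j, one of them is at most γ i j + 1, and a zigzag
-- w_i'j' → b_j' → w_ij' → a_i (or its transpose) then bounds every γ i' j' by
-- γ i j + (m − 1) + (n − 1) + 5.  On the other hand the mn colours γ i j are
-- distinct (they all meet at u), so two of them differ by at least mn − 1.  This
-- is a contradiction as soon as (m − 1)(n − 1) ≥ 6, in particular for m = 3, n = 4.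

open import Defs
open import Relation.Nullary using (¬_; yes; no)

open import Data.Nat using (ℕ; zero; suc; _+_; _*_; _∸_; _≤_; _<_; _≤?_; s≤s⁻¹)
open import Data.Nat.Properties
open import Data.Nat.Tactic.RingSolver using (solve-∀)
open import Data.Fin using (Fin; toℕ; fromℕ<; remQuot; combine)
  renaming (zero to fz; suc to fs)
open import Data.Fin.Properties
  using (injective⇒≤; toℕ-injective; toℕ-fromℕ<; toℕ≤pred[n]; combine-remQuot; any?)
open import Data.Unit using (tt)
open import Data.Empty using (⊥; ⊥-elim)
open import Data.Sum using (_⊎_; inj₁; inj₂)
open import Data.Product using (Σ; ∃; ∃₂; ∃-syntax; _×_; _,_; proj₁; proj₂; uncurry)
open import Function using (_∘_)
open import Function.Definitions using (Injective)
open import Relation.Binary.PropositionalEquality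
  using (_≡_; _≢_; refl; sym; trans; cong; subst; module ≡-Reasoning)

IntervalClosed : (ℕ → Set) → Set
IntervalClosed S = ∀ a b c → S a → S b → a ≤ c → c ≤ b → S c

-- Otherwise g k, g k + 1, …, g k + n + 1 would be n + 2 members
-- of S, and choosing a listing index for each gives an injection into Fin (n + 1).
narrow-window : ∀ {S : ℕ → Set} n (g : Fin (suc n) → ℕ) → IntervalClosed S →
                (∀ k → S (g k)) → (∀ c → S c → ∃ λ k → g k ≡ c) →
                ∀ k k′ → g k′ ≤ g k + n
narrow-window {S} n g closed listed covered k k′ with g k′ ≤? g k + n
... | yes within = within
... | no beyond = ⊥-elim (n≮n (suc n) (injective⇒≤ {f = index} index-injective))
  where
  far : g k + suc n ≤ g k′
  far = subst (_≤ g k′) (sym (+-suc (g k) n)) (≰⇒> beyond)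

  member : (m : Fin (suc (suc n))) → S (g k + toℕ m)
  member m = closed (g k) (g k′) _ (listed k) (listed k′) (m≤m+n (g k) (toℕ m))
                    (≤-trans (+-monoʳ-≤ (g k) (toℕ≤pred[n] m)) far)

  index : Fin (suc (suc n)) → Fin (suc n)
  index m = proj₁ (covered _ (member m))

  index-injective : Injective _≡_ _≡_ index
  index-injective {m} {m′} same = toℕ-injective (+-cancelˡ-≡ (g k) _ _ (begin
    g k + toℕ m    ≡⟨ sym (proj₂ (covered _ (member m))) ⟩
    g (index m)    ≡⟨ cong g same ⟩
    g (index m′)   ≡⟨ proj₂ (covered _ (member m′)) ⟩
    g k + toℕ m′   ∎))
    where open ≡-Reasoning

minimum : ∀ n (f : Fin (suc n) → ℕ) → ∃ λ i → ∀ j → f i ≤ f j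
minimum zero f = fz , λ { fz → ≤-refl }
minimum (suc n) f with minimum n (f ∘ fs)
... | i , least with f fz ≤? f (fs i)
...   | yes first = fz , λ { fz → ≤-refl ; (fs j) → ≤-trans first (least j) }
...   | no later  = fs i , λ { fz → <⇒≤ (≰⇒> later) ; (fs j) → least j }

-- n + 1 distinct naturals have width at least n: if every value were below
-- min + n, then j ↦ f j ∸ min would inject Fin (n + 1) into Fin n.
wide-window : ∀ n (f : Fin (suc n) → ℕ) → Injective _≡_ _≡_ f →
              ∃₂ λ i j → f i + n ≤ f j
wide-window n f f-injective with minimum n f
... | i , least with any? (λ j → f i + n ≤? f j)
...   | yes (j , far) = i , j , far
...   | no none = ⊥-elim (n≮n n (injective⇒≤ {f = offset} offset-injective))
  where
  offset-bound : ∀ j → f j ∸ f i < n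
  offset-bound j = +-cancelˡ-< (f i) _ _
    (subst (_< f i + n) (sym (m+[n∸m]≡n (least j))) (≰⇒> λ far → none (j , far)))

  offset : Fin (suc n) → Fin n
  offset j = fromℕ< (offset-bound j)

  offset-injective : Injective _≡_ _≡_ offset
  offset-injective {j} {j′} same = f-injective (begin
    f j                 ≡⟨ sym (m+[n∸m]≡n (least j)) ⟩
    f i + (f j ∸ f i)   ≡⟨ cong (f i +_) same-offset ⟩
    f i + (f j′ ∸ f i)  ≡⟨ m+[n∸m]≡n (least j′) ⟩
    f j′                ∎)
    where
    open ≡-Reasoning
    same-offset : f j ∸ f i ≡ f j′ ∸ f i
    same-offset = trans (sym (toℕ-fromℕ< (offset-bound j)))
                        (trans (cong toℕ same) (toℕ-fromℕ< (offset-bound j′)))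

≤+-trans : ∀ {x y z} m n → x ≤ y + m → y ≤ z + n → x ≤ z + (n + m)
≤+-trans {z = z} m n x≤ y≤ =
  ≤-trans x≤ (≤-trans (+-monoˡ-≤ m y≤) (≤-reflexive (+-assoc z n m)))

zigzag : ∀ {x y y′ z z′ w} s s′ → x ≤ y + 2 → y ≤ y′ + s → y′ ≤ z + 2 →
         z ≤ z′ + s′ → z′ ≤ w + 1 → x ≤ w + (s + s′ + 5)
zigzag {x} {w = w} s s′ x≤ y≤ y′≤ z≤ z′≤ =
  subst (λ d → x ≤ w + d) (total s s′)
    (≤+-trans _ 1 (≤+-trans _ s′ (≤+-trans _ 2 (≤+-trans 2 s x≤ y≤) y′≤) z≤) z′≤)
  where
  total : ∀ s s′ → 1 + (s′ + (2 + (s + 2))) ≡ s + s′ + 5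
  total = solve-∀

below-top : ∀ {x y} z → x ≢ y → x ≤ z + 2 → y ≤ z + 2 → x ≤ z + 1 ⊎ y ≤ z + 1
below-top z x≢y x≤ y≤ rewrite +-suc z 1 with m≤n⇒m<n∨m≡n x≤ | m≤n⇒m<n∨m≡n y≤
... | inj₁ x< | _         = inj₁ (s≤s⁻¹ x<)
... | inj₂ _  | inj₁ y<   = inj₂ (s≤s⁻¹ y<)
... | inj₂ refl | inj₂ refl = ⊥-elim (x≢y refl)

-- For ab ≥ 6 the lower bound (a + 1)(b + 1) − 1 on the apex width beats the
-- upper bound a + b + 5.
apex-clash : ∀ a b → 6 ≤ a * b → a + b + 5 < b + a * suc b
apex-clash a b 6≤ab = begin-strict
  a + b + 5      <⟨ +-monoʳ-< (a + b) 6≤ab ⟩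
  a + b + a * b  ≡⟨ rearrange a b ⟩
  b + a * suc b  ∎
  where
  open ≤-Reasoning
  rearrange : ∀ a b → a + b + a * b ≡ b + a * suc b
  rearrange = solve-∀

module _ {G : Graph} {t : ℕ} (C : IntervalColouring G t) where
  open IntervalColouring C

  Colours : V G → ℕ → Set
  Colours v c = ∃[ x ] Σ (E G v x) λ e → col v x e ≡ c

  colour-at-far-end : ∀ {u v} (e : E G u v) → Colours v (col u v e)
  colour-at-far-end {u} {v} e = u , symE G e , sym (col-sym u v e)

  vertex-window : ∀ v d (g : Fin (suc d) → ℕ) → (∀ k → Colours v (g k)) →
                  (∀ c → Colours v c → ∃ λ k → g k ≡ c) → ∀ k k′ → g k′ ≤ g k + d
  vertex-window v d g = narrow-window d g (interval v)

module _ {m n : ℕ} where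
  left : Fin m → HV m n
  left i = inj₁ (inj₁ i)

  right : Fin n → HV m n
  right j = inj₁ (inj₂ j)

  sub : Fin m → Fin n → HV m n
  sub i j = inj₂ (inj₁ (i , j))

  apex : HV m n
  apex = inj₂ (inj₂ tt)

  sub-injective : ∀ {p q : Fin m × Fin n} → uncurry sub p ≡ uncurry sub q → p ≡ q
  sub-injective refl = refl

module HatColouring {a b t : ℕ} (C : IntervalColouring (hatK (suc a) (suc b)) t) where
  open IntervalColouring C

  α β γ : Fin (suc a) → Fin (suc b) → ℕ
  α i j = col (left i) (sub i j) refl
  β i j = col (right j) (sub i j) refl
  γ i j = col apex (sub i j) tt

  -- a_i has degree b + 1, its colours being the α i j.
  row-window : ∀ i j j′ → α i j′ ≤ α i j + b
  row-window i = vertex-window C (left i) b (α i) (λ j → sub i j , refl , refl) listed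
    where
    listed : ∀ c → Colours C (left i) c → ∃ λ j → α i j ≡ c
    listed c (inj₂ (inj₁ (_ , j)) , refl , same) = j , same
    listed c (inj₁ (inj₁ _) , () , _)
    listed c (inj₁ (inj₂ _) , () , _)
    listed c (inj₂ (inj₂ _) , () , _)

  -- b_j has degree a + 1, its colours being the β i j.
  column-window : ∀ j i i′ → β i′ j ≤ β i j + a
  column-window j = vertex-window C (right j) a (λ i → β i j) (λ i → sub i j , refl , refl) listed
    where
    listed : ∀ c → Colours C (right j) c → ∃ λ i → β i j ≡ c
    listed c (inj₂ (inj₁ (i , _)) , refl , same) = i , same
    listed c (inj₁ (inj₁ _) , () , _)
    listed c (inj₁ (inj₂ _) , () , _)
    listed c (inj₂ (inj₂ _) , () , _)

  -- w_ij has degree 3, its colours being α i j, β i j and γ i j.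
  cell : Fin (suc a) → Fin (suc b) → Fin 3 → ℕ
  cell i j fz           = α i j
  cell i j (fs fz)      = β i j
  cell i j (fs (fs fz)) = γ i j

  cell-window : ∀ i j k k′ → cell i j k′ ≤ cell i j k + 2
  cell-window i j = vertex-window C (sub i j) 2 (cell i j) present listed
    where
    present : ∀ k → Colours C (sub i j) (cell i j k)
    present fz           = colour-at-far-end C {left i} {sub i j} refl
    present (fs fz)      = colour-at-far-end C {right j} {sub i j} refl
    present (fs (fs fz)) = colour-at-far-end C {apex} {sub i j} tt

    listed : ∀ c → Colours C (sub i j) c → ∃ λ k → cell i j k ≡ c
    listed c (inj₁ (inj₁ _) , refl , same) = fz , trans (col-sym _ _ refl) same
    listed c (inj₁ (inj₂ _) , refl , same) = fs fz , trans (col-sym _ _ refl) same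
    listed c (inj₂ (inj₂ _) , _ , same)    = fs (fs fz) , trans (col-sym _ _ tt) same
    listed c (inj₂ (inj₁ _) , () , _)

  α≢β : ∀ i j → α i j ≢ β i j
  α≢β i j same
    with proper (sub i j) (left i) (right j) refl refl
           (trans (sym (col-sym _ _ refl)) (trans same (col-sym _ _ refl)))
  ... | ()

  apex-narrow : ∀ p q → uncurry γ q ≤ uncurry γ p + (a + b + 5)
  apex-narrow (i , j) (i′ , j′)
    with below-top (γ i j) (α≢β i j) (cell-window i j (fs (fs fz)) fz)
                                     (cell-window i j (fs (fs fz)) (fs fz))
  ... | inj₁ α-low =
    zigzag a b (cell-window i′ j′ (fs fz) (fs (fs fz))) (column-window j′ i i′)
               (cell-window i j′ fz (fs fz)) (row-window i j j′) α-low
  ... | inj₂ β-low =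
    subst (λ d → γ i′ j′ ≤ γ i j + d) (cong (_+ 5) (+-comm b a))
      (zigzag b a (cell-window i′ j′ fz (fs (fs fz))) (row-window i′ j j′)
                  (cell-window i′ j (fs fz) fz) (column-window j i i′) β-low)

  position : Fin (suc a * suc b) → Fin (suc a) × Fin (suc b)
  position = remQuot (suc b)

  apex-colour : Fin (suc a * suc b) → ℕ
  apex-colour = uncurry γ ∘ position

  apex-colour-injective : Injective _≡_ _≡_ apex-colour
  apex-colour-injective {x} {y} same = begin
    x                               ≡⟨ sym (combine-remQuot {suc a} (suc b) x) ⟩
    uncurry combine (position x)    ≡⟨ cong (uncurry combine) same-position ⟩
    uncurry combine (position y)    ≡⟨ combine-remQuot {suc a} (suc b) y ⟩
    y                               ∎
    where
    open ≡-Reasoning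
    same-position : position x ≡ position y
    same-position = sub-injective (proper apex _ _ tt tt same)

  impossible : 6 ≤ a * b → ⊥
  impossible 6≤ab with wide-window _ apex-colour apex-colour-injective
  ... | x , y , wide =
    <⇒≱ (apex-clash a b 6≤ab)
        (+-cancelˡ-≤ (apex-colour x) _ _
          (≤-trans wide (apex-narrow (position x) (position y))))

hatK-not-interval : ∀ a b → 6 ≤ a * b → ¬ InN (hatK (suc a) (suc b))
hatK-not-interval a b 6≤ab (_ , _ , C) = HatColouring.impossible C 6≤ab

-- (m − 1)(n − 1) = 2 · 3 = 6.
theorem11 : ¬ InN (hatK 3 4)
theorem11 = hatK-not-interval 2 3 ≤-refl
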